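{- Let $c$ be a sorted configuration on $K_{m,n}$ satisfying the compact range assumption. Then $$T^{\le n}(c)=(c_n-m,c_1,\dots,c_{n-1},1+c_{n+1},\dots,1+c_{n+m-1})$$ and $$T^{>n}(c)=(1+c_1,\dots,1+c_n,c_{n+m-1}-n,c_{n+1},\dots,c_{n+m-2}),$$ and both of these configurations satisfy the compact range assumption.
   Context: $K_{m,n}$ ($m,n$ positive integers) has vertices $v_1,\dots,v_{n+m}$, with a single edge between $v_i$ and $v_j$ exactly when $i\le n<j$; the sink is $v_{n+m}$. A configuration is $c=(c_1,\dots,c_{n+m-1})\in\mathbb{Z}^{n+m-1}$ (the sink height is ignored). Toppling $v_i$ with $i\le n$ decreases $c_i$ by $m$ and increases each of $c_{n+1},\dots,c_{n+m-1}$ by $1$; toppling $v_i$ with $n<i<n+m$ decreases $c_i$ by $n$ and increases each of $c_1,\dots,c_n$ by $1$. $c$ is sorted if $c_1\le\dots\le c_n$ and $c_{n+1}\le\dots\le c_{n+m-1}$. $c$ satisfies the compact range assumption if $\max(c_1,\dots,c_n)-\min(c_1,\dots,c_n)\le m$ and $\max(c_{n+1},\dots,c_{n+m-1})-\min(c_{n+1},\dots,c_{n+m-1})\le n$. For a sorted $c$, $T^{\le n}(c)$ is obtained by toppling $v_n$ and then sorting the entries $1,\dots,n$ into weakly increasing order; $T^{>n}(c)$ is obtained by toppling $v_{n+m-1}$ and then sorting the entries $n+1,\dots,n+m-1$ into weakly increasing order. -}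

module Defs where

open import Data.Nat using (ℕ; zero; suc)
open import Data.Integer using (ℤ; +_; _+_; _-_; _≤_; _≤?_)
open import Data.Fin using (Fin; _≤_; fromℕ)
open import Data.Vec using (Vec; []; _∷_; map; updateAt; lookup)
open import Data.Product using (_×_; _,_)
open import Relation.Nullary using (yes; no)

-- A configuration on K_{m,n} (sink v_{n+m} ignored) with n vertices on the
-- first side and k = m - 1 non-sink vertices on the second side:
-- (c_1,…,c_n) , (c_{n+1},…,c_{n+m-1}).
Config : ℕ → ℕ → Set
Config n k = Vec ℤ n × Vec ℤ k

toppleLeft : ∀ {n k} (m : ℕ) → Fin n → Config n k → Config n k
toppleLeft m i (a , b) = updateAt a i (λ x → x - + m) , map (λ y → + 1 + y) b

toppleRight : ∀ {n k} → Fin k → Config n k → Config n k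
toppleRight {n} j (a , b) = map (λ x → + 1 + x) a , updateAt b j (λ y → y - + n)

insert : ∀ {n} → ℤ → Vec ℤ n → Vec ℤ (suc n)
insert x [] = x ∷ []
insert x (y ∷ ys) with x ≤? y
... | yes _ = x ∷ y ∷ ys
... | no  _ = y ∷ insert x ys

sort : ∀ {n} → Vec ℤ n → Vec ℤ n
sort [] = []
sort (x ∷ xs) = insert x (sort xs)

SortedVec : ∀ {n} → Vec ℤ n → Set
SortedVec {n} v = ∀ (i j : Fin n) → i Data.Fin.≤ j → lookup v i Data.Integer.≤ lookup v j

Sorted : ∀ {n k} → Config n k → Set
Sorted (a , b) = SortedVec a × SortedVec b

-- max(v) - min(v) ≤ d, written out pairwise (vacuous for an empty vector).
RangeWithin : ∀ {n} → ℕ → Vec ℤ n → Set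
RangeWithin {n} d v = ∀ (i j : Fin n) → lookup v i - lookup v j Data.Integer.≤ + d

CompactRange : ∀ {n k} (m : ℕ) → Config n k → Set
CompactRange {n} m (a , b) = RangeWithin m a × RangeWithin n b

-- T^{≤n}: topple v_n (last vertex of the first side, needs n ≥ 1), then sort entries 1..n.
Tle : ∀ {n k} (m : ℕ) → Config (suc n) k → Config (suc n) k
Tle {n} m c with toppleLeft m (fromℕ n) c
... | (a , b) = sort a , b

-- T^{>n}: topple v_{n+m-1} (last non-sink vertex of the second side, needs m ≥ 2),
-- then sort entries n+1..n+m-1.
Tgt : ∀ {n k} → Config n (suc k) → Config n (suc k)
Tgt {k = k} c with toppleRight (fromℕ k) c
... | (a , b) = a , sort b

module Submission where

-- Toppling the largest entry of a sorted vector whose range is at most d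
-- lowers it by d, to at most the smallest entry: sorting then merely rotates
-- it to the front, and the rotated vector lies in [last - d, last], so its
-- range is again at most d. The other side only shifts by 1.

open import Defs
open import Data.Nat using (ℕ; suc; z≤n; s≤s)
open import Data.Integer using (ℤ; +_; _+_; _-_; _≤_; _≤?_)
open import Data.Integer.Properties
  using (≤-refl; ≤-trans; ≤-antisym; +-mono-≤; neg-mono-≤; i-j≤i; i≤j⇒i-j≤0; i-j≤0⇒i≤j; module ≤-Reasoning)
open import Data.Integer.Tactic.RingSolver using (solve-∀)
open import Data.Fin using (Fin; zero; suc; fromℕ; inject₁)
open import Data.Fin.Properties using (≤fromℕ; toℕ-inject₁)
open import Data.Vec using (Vec; []; _∷_; _∷ʳ_; map; init; last; lookup; updateAt)
open import Data.Vec.Properties using (lookup-map)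
open import Data.Product using (_×_; _,_; proj₁; proj₂)
open import Data.Empty using (⊥-elim)
open import Function using (_∘_)
open import Relation.Nullary using (yes; no)
open import Relation.Binary.PropositionalEquality
  using (_≡_; refl; sym; cong; cong₂; subst; subst₂; module ≡-Reasoning)
import Data.Nat as ℕ

private
  variable
    A : Set
    n : ℕ

lookup-init : (v : Vec A (suc n)) (i : Fin n) → lookup (init v) i ≡ lookup v (inject₁ i)
lookup-init (x ∷ y ∷ ys) zero    = refl
lookup-init (x ∷ y ∷ ys) (suc i) = lookup-init (y ∷ ys) i

lookup-fromℕ : (v : Vec A (suc n)) → lookup v (fromℕ n) ≡ last v
lookup-fromℕ (x ∷ [])     = refl
lookup-fromℕ (x ∷ y ∷ ys) = lookup-fromℕ (y ∷ ys)

updateAt-fromℕ : (v : Vec A (suc n)) (f : A → A) → updateAt v (fromℕ n) f ≡ init v ∷ʳ f (last v)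
updateAt-fromℕ (x ∷ [])     f = refl
updateAt-fromℕ (x ∷ y ∷ ys) f = cong (x ∷_) (updateAt-fromℕ (y ∷ ys) f)

SortedVec-tail : ∀ {x} {xs : Vec ℤ n} → SortedVec (x ∷ xs) → SortedVec xs
SortedVec-tail s i j i≤j = s (suc i) (suc j) (s≤s i≤j)

SortedVec-head≤ : ∀ {x} {xs : Vec ℤ n} → SortedVec (x ∷ xs) → ∀ i → x ≤ lookup xs i
SortedVec-head≤ s i = s zero (suc i) z≤n

SortedVec-init : {v : Vec ℤ (suc n)} → SortedVec v → SortedVec (init v)
SortedVec-init {v = v} s i j i≤j =
  subst₂ _≤_ (sym (lookup-init v i)) (sym (lookup-init v j))
    (s (inject₁ i) (inject₁ j) (subst₂ ℕ._≤_ (sym (toℕ-inject₁ i)) (sym (toℕ-inject₁ j)) i≤j))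

SortedVec-≤last : {v : Vec ℤ (suc n)} → SortedVec v → ∀ i → lookup v i ≤ last v
SortedVec-≤last {n} {v} s i = subst (lookup v i ≤_) (lookup-fromℕ v) (s i (fromℕ n) (≤fromℕ i))

insert-least : ∀ {x} (ys : Vec ℤ n) → (∀ i → x ≤ lookup ys i) → insert x ys ≡ x ∷ ys
insert-least []       x≤ys = refl
insert-least {x = x} (y ∷ ys) x≤ys with x ≤? y
... | yes _  = refl
... | no x≰y = ⊥-elim (x≰y (x≤ys zero))

insert-second : ∀ {x y} (ys : Vec ℤ n) → y ≤ x → (∀ i → x ≤ lookup ys i) →
                insert x (y ∷ ys) ≡ y ∷ x ∷ ys
insert-second {x = x} {y} ys y≤x x≤ys with x ≤? y
... | yes x≤y rewrite ≤-antisym x≤y y≤x = refl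
... | no _    = cong (y ∷_) (insert-least ys x≤ys)

sort-∷ʳ-least : ∀ {y} (xs : Vec ℤ n) → SortedVec xs → (∀ i → y ≤ lookup xs i) →
                sort (xs ∷ʳ y) ≡ y ∷ xs
sort-∷ʳ-least []       s y≤xs = refl
sort-∷ʳ-least {y = y} (x ∷ xs) s y≤xs = begin
  insert x (sort (xs ∷ʳ y))
    ≡⟨ cong (insert x) (sort-∷ʳ-least xs (SortedVec-tail s) (λ i → y≤xs (suc i))) ⟩
  insert x (y ∷ xs)         ≡⟨ insert-second xs (y≤xs zero) (SortedVec-head≤ s) ⟩
  y ∷ x ∷ xs                ∎
  where open ≡-Reasoning

i-j≤k⇒i-k≤j : ∀ {i j k} → i - j ≤ k → i - k ≤ j
i-j≤k⇒i-k≤j {i} {j} {k} i-j≤k =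
  i-j≤0⇒i≤j (subst (_≤ + 0) (reorder i j k) (i≤j⇒i-j≤0 i-j≤k))
  where
  reorder : ∀ i j k → (i - j) - k ≡ (i - k) - j
  reorder = solve-∀

Between : ℕ → ℤ → ℤ → Set
Between d hi e = hi - + d ≤ e × e ≤ hi

RangeWithin-between : ∀ d hi (w : Vec ℤ n) → (∀ i → Between d hi (lookup w i)) → RangeWithin d w
RangeWithin-between d hi w bounds i j = begin
  lookup w i - lookup w j ≤⟨ +-mono-≤ (proj₂ (bounds i)) (neg-mono-≤ (proj₁ (bounds j))) ⟩
  hi - (hi - + d)         ≡⟨ cancel hi (+ d) ⟩
  + d                     ∎
  where
  open ≤-Reasoning
  cancel : ∀ h e → h - (h - e) ≡ e
  cancel = solve-∀

RangeWithin-translate : ∀ d c (v : Vec ℤ n) → RangeWithin d v → RangeWithin d (map (λ y → c + y) v)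
RangeWithin-translate d c v r i j = begin
  lookup (map (λ y → c + y) v) i - lookup (map (λ y → c + y) v) j
    ≡⟨ cong₂ _-_ (lookup-map i (λ y → c + y) v) (lookup-map j (λ y → c + y) v) ⟩
  (c + lookup v i) - (c + lookup v j) ≡⟨ cancel c (lookup v i) (lookup v j) ⟩
  lookup v i - lookup v j             ≤⟨ r i j ⟩
  + d                                 ∎
  where
  open ≤-Reasoning
  cancel : ∀ c x y → (c + x) - (c + y) ≡ x - y
  cancel = solve-∀

module _ {p : ℕ} (d : ℕ) {v : Vec ℤ (suc p)} (sorted : SortedVec v) (range : RangeWithin d v) where

  private
    L : ℤ
    L = last v

  between-last : ∀ i → Between d L (lookup v i)
  between-last i = ≤-trans L-d≤head (sorted zero i z≤n) , SortedVec-≤last sorted i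
    where
    L-d≤head : L - + d ≤ lookup v zero
    L-d≤head = i-j≤k⇒i-k≤j {L}
      (subst (λ l → l - lookup v zero ≤ + d) (lookup-fromℕ v) (range (fromℕ p) zero))

  between-init : ∀ i → Between d L (lookup (init v) i)
  between-init i = subst (Between d L) (sym (lookup-init v i)) (between-last (inject₁ i))

  sort-topple-last : sort (updateAt v (fromℕ p) (_- + d)) ≡ (L - + d) ∷ init v
  sort-topple-last = begin
    sort (updateAt v (fromℕ p) (_- + d)) ≡⟨ cong sort (updateAt-fromℕ v (_- + d)) ⟩
    sort (init v ∷ʳ (L - + d))
      ≡⟨ sort-∷ʳ-least (init v) (SortedVec-init sorted) (proj₁ ∘ between-init) ⟩
    (L - + d) ∷ init v                  ∎
    where
    open ≡-Reasoning

  RangeWithin-rotated : RangeWithin d ((L - + d) ∷ init v)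
  RangeWithin-rotated = RangeWithin-between d L ((L - + d) ∷ init v) bounds
    where
    bounds : ∀ i → Between d L (lookup ((L - + d) ∷ init v) i)
    bounds zero    = ≤-refl , i-j≤i L (+ d)
    bounds (suc i) = between-init i

Tle-sorted-compact : ∀ (j k : ℕ) (a : Vec ℤ (suc j)) (b : Vec ℤ k) →
  Sorted (a , b) → CompactRange (suc k) (a , b) →
  (Tle (suc k) (a , b) ≡ ((last a - + suc k) ∷ init a , map (λ y → + 1 + y) b))
  × CompactRange (suc k) (Tle (suc k) (a , b))
Tle-sorted-compact j k a b (sa , _) (ra , rb) =
  Tle≡ , subst (CompactRange (suc k)) (sym Tle≡)
                (RangeWithin-rotated (suc k) sa ra , RangeWithin-translate (suc j) (+ 1) b rb)
  where
  Tle≡ : Tle (suc k) (a , b) ≡ ((last a - + suc k) ∷ init a , map (λ y → + 1 + y) b)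
  Tle≡ = cong (_, map (λ y → + 1 + y) b) (sort-topple-last (suc k) sa ra)

Tgt-sorted-compact : ∀ (j k : ℕ) (a : Vec ℤ (suc j)) (b : Vec ℤ (suc k)) →
  Sorted (a , b) → CompactRange (suc (suc k)) (a , b) →
  (Tgt (a , b) ≡ (map (λ x → + 1 + x) a , (last b - + suc j) ∷ init b))
  × CompactRange (suc (suc k)) (Tgt (a , b))
Tgt-sorted-compact j k a b (_ , sb) (ra , rb) =
  Tgt≡ , subst (CompactRange (suc (suc k))) (sym Tgt≡)
                (RangeWithin-translate (suc (suc k)) (+ 1) a ra , RangeWithin-rotated (suc j) sb rb)
  where
  Tgt≡ : Tgt (a , b) ≡ (map (λ x → + 1 + x) a , (last b - + suc j) ∷ init b)
  Tgt≡ = cong (map (λ x → + 1 + x) a ,_) (sort-topple-last (suc j) sb rb)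

lemma4p1 : (∀ (j k : ℕ) (a : Vec ℤ (suc j)) (b : Vec ℤ k) →
              Sorted (a , b) → CompactRange (suc k) (a , b) →
              (Tle (suc k) (a , b) ≡ ((last a - + suc k) ∷ init a , map (λ y → + 1 + y) b))
              × CompactRange (suc k) (Tle (suc k) (a , b)))
           × (∀ (j k : ℕ) (a : Vec ℤ (suc j)) (b : Vec ℤ (suc k)) →
              Sorted (a , b) → CompactRange (suc (suc k)) (a , b) →
              (Tgt (a , b) ≡ (map (λ x → + 1 + x) a , (last b - + suc j) ∷ init b))
              × CompactRange (suc (suc k)) (Tgt (a , b)))
lemma4p1 = Tle-sorted-compact , Tgt-sorted-compact
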